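{- Let $S=\{s_2,s_1\}\subset\mathbb{N}$ with $s_2<s_1$ and $2s_2\le s_1$. Then under any tie-breaking setting $X\in\tau=\{\mathrm{FvF},\mathrm{FvA},\mathrm{AvF},\mathrm{AvA}\}$, a player cannot benefit strictly by sacrificing. That is, for every heap size $h\ge s_1$, $$s_1+o^2_{\mathsf d(X)}(h-s_1)\ \ge\ s_2+o^2_{\mathsf d(X)}(h-s_2).$$
   Context: Self-interest cumulative subtraction game: for a finite set $S\subset\mathbb{N}$, there is one heap of $h\in\mathbb{N}_0$ tokens. Two players alternately remove $s\in S$ tokens (with $s\le h$) and add $s$ to their own score. The game ends when $h<\min S$. Each player maximizes their own final score. In case of indifference, each player follows a fixed deterministic tie-breaking convention: friendly (F), maximizing the opponent's score, or antagonistic (A), minimizing it. In $\tau$, the first letter is the convention of the player to move (player 1) and the second letter is that of the other player (player 2). The dual $\mathsf d$ fixes $\mathrm{FvF}$ and $\mathrm{AvA}$ and swaps $\mathrm{AvF}\leftrightarrow\mathrm{FvA}$. Outcomes are defined recursively as follows. - If $h<\min S$, then $o^1_X(h)=o^2_X(h)=0$. - Otherwise, let $S(h)=S\cap\{1,\ldots,h\}$ and $o^1_X(h)=\max_{s\in S(h)}\big(s+o^2_{\mathsf d(X)}(h-s)\big)$. Let $S^*(h)$ be the set of maximizers. Then $o^2_X(h)=o^1_{\mathsf d(X)}(h-s^*)$, where $s^*$ minimizes $o^1_{\mathsf d(X)}(h-s)$ over $S^*(h)$ if $X\in\{\mathrm{AvF},\mathrm{AvA}\}$, and maximizes it otherwise.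 A greedy move from $h\ge s_1$ removes $s_1$; removing $s_2$ instead is a sacrifice. -}

module Defs where

open import Data.Nat using (ℕ; zero; suc; _+_; _∸_; _⊔_; _⊓_; _<ᵇ_; _≡ᵇ_)
open import Data.Bool using (Bool; true; false; if_then_else_)
open import Data.Product using (_×_; _,_; proj₁; proj₂)

-- Tie-breaking conventions: friendly (F) / antagonistic (A).
data Conv : Set where
  F A : Conv

-- A setting X = (convention of player to move , convention of the other player).
Setting : Set
Setting = Conv × Conv

FvF FvA AvF AvA : Setting
FvF = F , F
FvA = F , A
AvF = A , F
AvA = A , A

d : Setting → Setting
d (a , b) = (b , a)

-- Tie-break among maximizers by the convention of the player to move:
-- A (X ∈ {AvF, AvA}) minimizes the opponent's score, F maximizes it.
tieBreak : Setting → ℕ → ℕ → ℕ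
tieBreak (A , _) x y = x ⊓ y
tieBreak (F , _) x y = x ⊔ y

-- Outcomes (o¹_X(h) , o²_X(h)) for the game with S = {s₂ , s₁}, s₂ < s₁,
-- computed with fuel; the result is correct whenever fuel > h (given s₂ ≥ 1).
-- Arguments: s₁ s₂ fuel X h.
outF : ℕ → ℕ → ℕ → Setting → ℕ → ℕ × ℕ
outF s₁ s₂ zero X h = 0 , 0
outF s₁ s₂ (suc n) X h =
  if h <ᵇ s₂ then (0 , 0)
  else if h <ᵇ s₁ then
    (s₂ + proj₂ r₂ , proj₁ r₂)
  else
    (v₁ ⊔ v₂ ,
      (if v₂ <ᵇ v₁ then proj₁ r₁
       else if v₁ <ᵇ v₂ then proj₁ r₂
       else tieBreak X (proj₁ r₁) (proj₁ r₂)))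
  where
  r₁ = outF s₁ s₂ n (d X) (h ∸ s₁)
  r₂ = outF s₁ s₂ n (d X) (h ∸ s₂)
  v₁ = s₁ + proj₂ r₁
  v₂ = s₂ + proj₂ r₂

o¹ : ℕ → ℕ → Setting → ℕ → ℕ
o¹ s₁ s₂ X h = proj₁ (outF s₁ s₂ (suc h) X h)

o² : ℕ → ℕ → Setting → ℕ → ℕ
o² s₁ s₂ X h = proj₂ (outF s₁ s₂ (suc h) X h)

{-# OPTIONS --safe #-}
-- Write s₁ = s₂ + c, so that c ≥ s₂, and compare greedy play (always remove
-- s₁ when possible) from the heaps c + m and m. Adding c tokens raises the
-- greedy score of either player by less than c, or by exactly c while leaving
-- the other player's score unchanged. This is proved for both players at once
-- along greedy play, a greedy move swapping their roles; heaps below s₁ are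
-- checked directly, which is where c ≥ s₂ enters. With h − s₂ = c + (h − s₁)
-- it says that the sacrifice s₂ either scores strictly less than the greedy
-- move s₁ or leads to exactly the same outcome. Hence under every tie-breaking
-- convention the game is played greedily, and the sacrifice never scores more.
module Submission where

open import Defs
open import Data.Nat using (ℕ; zero; suc; _+_; _∸_; _≤_; _<_; _*_; _<ᵇ_; _⊔_; z≤n; s≤s; _<?_)
open import Data.Nat.Properties
open import Data.Bool using (true; false; if_then_else_)
open import Data.Bool.Properties using (T-≡; ¬-not)
open import Data.Empty using (⊥-elim)
open import Data.Sum using (inj₁; inj₂)
open import Data.Product using (_×_; _,_; proj₁; proj₂; map₁; map₂)
open import Function using (_∘_; _on_; id)
open import Function.Bundles using (Equivalence)
open import Level using (0ℓ)
open import Relation.Binary.Core using (Rel)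
open import Relation.Binary.Construct.Closure.Reflexive as RC using (ReflClosure; [_]; reflexive)
open import Relation.Binary.PropositionalEquality
open import Relation.Nullary using (yes; no)
open import Algebra.Properties.CommutativeSemigroup +-commutativeSemigroup using (x∙yz≈y∙xz)

<⇒<ᵇ≡true : ∀ {m n} → m < n → (m <ᵇ n) ≡ true
<⇒<ᵇ≡true = Equivalence.to T-≡ ∘ <⇒<ᵇ

≥⇒<ᵇ≡false : ∀ {m n} → n ≤ m → (m <ᵇ n) ≡ false
≥⇒<ᵇ≡false {m} {n} n≤m = ¬-not (λ m<ᵇn → <⇒≱ (<ᵇ⇒< m n (Equivalence.from T-≡ m<ᵇn)) n≤m)

s+y<1+n⇒y<n : ∀ {s y n} → 1 ≤ s → s + y < suc n → y < n
s+y<1+n⇒y<n {s} {y} 1≤s s+y<1+n = <-≤-trans (m<n+m y 1≤s) (≤-pred s+y<1+n)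

tieBreak-idem : ∀ X x → tieBreak X x x ≡ x
tieBreak-idem (A , _) = ⊓-idem
tieBreak-idem (F , _) = ⊔-idem

move : ℕ → ℕ × ℕ → ℕ × ℕ
move s (x , y) = s + y , x

move-+ : ∀ s t p → move (s + t) p ≡ move s (map₂ (t +_) p)
move-+ s t (x , y) = cong (_, x) (+-assoc s t y)

move-map₂ : ∀ s t p → move s (map₂ (t +_) p) ≡ map₁ (t +_) (move s p)
move-map₂ s t (x , y) = cong (_, x) (x∙yz≈y∙xz s t y)

move-total-≤ : ∀ s {p y} → proj₁ p + proj₂ p ≤ y → proj₁ (move s p) + proj₂ (move s p) ≤ s + y
move-total-≤ s {x , y′} {y} x+y′≤y = begin
  s + y′ + x   ≡⟨ +-assoc s y′ x ⟩
  s + (y′ + x) ≡⟨ cong (s +_) (+-comm y′ x) ⟩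
  s + (x + y′) ≤⟨ +-monoʳ-≤ s x+y′≤y ⟩
  s + y        ∎
  where open ≤-Reasoning

choose : Setting → ℕ × ℕ → ℕ × ℕ → ℕ × ℕ
choose X (v₁ , w₁) (v₂ , w₂) =
  v₁ ⊔ v₂ , (if v₂ <ᵇ v₁ then w₁ else if v₁ <ᵇ v₂ then w₂ else tieBreak X w₁ w₂)

-- p ⊑₁ q: the player to move does strictly better with q, or p and q are the
-- same outcome; in both cases q is chosen whatever the tie-breaking convention.
_⊑₁_ _⊑₂_ : Rel (ℕ × ℕ) 0ℓ
_⊑₁_ = ReflClosure (_<_ on proj₁)
_⊑₂_ = ReflClosure (_<_ on proj₂)

⊑₁⇒≤ : ∀ {p q} → p ⊑₁ q → proj₁ p ≤ proj₁ q
⊑₁⇒≤ [ p<q ] = <⇒≤ p<q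
⊑₁⇒≤ RC.refl = ≤-refl

≤⇒⊑₁ : ∀ {x y z} → x ≤ y → (x , z) ⊑₁ (y , z)
≤⇒⊑₁ x≤y with m≤n⇒m<n∨m≡n x≤y
... | inj₁ x<y  = [ x<y ]
... | inj₂ refl = RC.refl

choose-⊑₁ : ∀ X {p q} → q ⊑₁ p → choose X p q ≡ p
choose-⊑₁ X {v , w} [ v′<v ] rewrite <⇒<ᵇ≡true v′<v | m≥n⇒m⊔n≡m (<⇒≤ v′<v) = refl
choose-⊑₁ X {v , w} RC.refl rewrite ⊔-idem v | ≥⇒<ᵇ≡false (≤-refl {v}) | tieBreak-idem X w = refl

move-mono₁ : ∀ s {p q} → p ⊑₁ q → move s p ⊑₂ move s q
move-mono₁ s = RC.map {f = move s} id

move-mono₂ : ∀ s {p q} → p ⊑₂ q → move s p ⊑₁ move s q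
move-mono₂ s = RC.map {f = move s} (+-monoʳ-< s)

module Greedy (s₂ c : ℕ) where

  s₁ : ℕ
  s₁ = s₂ + c

  data Range : ℕ → Set where
    below  : ∀ {h} → h < s₂ → Range h
    middle : ∀ {y} → y < c → Range (s₂ + y)
    above  : ∀ y → Range (s₁ + y)

  range : ∀ h → Range h
  range h with h <? s₂
  ... | yes h<s₂ = below h<s₂
  ... | no h≮s₂ with m≤n⇒∃[o]m+o≡n (≮⇒≥ h≮s₂)
  ...   | y , refl with y <? c
  ...     | yes y<c = middle y<c
  ...     | no y≮c with m≤n⇒∃[o]m+o≡n (≮⇒≥ y≮c)
  ...       | z , refl = subst Range (+-assoc s₂ c z) (above z)

  s₁+y∸s₂≡c+y : ∀ y → s₁ + y ∸ s₂ ≡ c + y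
  s₁+y∸s₂≡c+y y = trans (cong (_∸ s₂) (+-assoc s₂ c y)) (m+n∸m≡n s₂ (c + y))

  -- Greedy play stopped after n moves. The results below hold for every
  -- cut-off n, so greedy n can be matched with outF at the same fuel n.
  greedy : ℕ → ℕ → ℕ × ℕ
  greedy zero    h = 0 , 0
  greedy (suc n) h =
    if h <ᵇ s₂ then (0 , 0)
    else if h <ᵇ s₁ then move s₂ (greedy n (h ∸ s₂))
    else move s₁ (greedy n (h ∸ s₁))

  greedy-below : ∀ n {h} → h < s₂ → greedy n h ≡ (0 , 0)
  greedy-below zero    _    = refl
  greedy-below (suc n) h<s₂ rewrite <⇒<ᵇ≡true h<s₂ = refl

  greedy-middle : ∀ n {y} → y < c → greedy (suc n) (s₂ + y) ≡ move s₂ (greedy n y)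
  greedy-middle n {y} y<c
    rewrite ≥⇒<ᵇ≡false (m≤m+n s₂ y) | <⇒<ᵇ≡true (+-monoʳ-< s₂ y<c) | m+n∸m≡n s₂ y = refl

  greedy-above : ∀ n y → greedy (suc n) (s₁ + y) ≡ move s₁ (greedy n y)
  greedy-above n y
    rewrite ≥⇒<ᵇ≡false (≤-trans (m≤m+n s₂ c) (m≤m+n s₁ y)) | ≥⇒<ᵇ≡false (m≤m+n s₁ y)
          | m+n∸m≡n s₁ y = refl

  outF-below : ∀ n X {h} → h < s₂ → outF s₁ s₂ (suc n) X h ≡ (0 , 0)
  outF-below n X h<s₂ rewrite <⇒<ᵇ≡true h<s₂ = refl

  outF-middle : ∀ n X {y} → y < c → outF s₁ s₂ (suc n) X (s₂ + y) ≡ move s₂ (outF s₁ s₂ n (d X) y)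
  outF-middle n X {y} y<c
    rewrite ≥⇒<ᵇ≡false (m≤m+n s₂ y) | <⇒<ᵇ≡true (+-monoʳ-< s₂ y<c) | m+n∸m≡n s₂ y = refl

  outF-above : ∀ n X y → outF s₁ s₂ (suc n) X (s₁ + y) ≡
    choose X (move s₁ (outF s₁ s₂ n (d X) y)) (move s₂ (outF s₁ s₂ n (d X) (c + y)))
  outF-above n X y
    rewrite ≥⇒<ᵇ≡false (≤-trans (m≤m+n s₂ c) (m≤m+n s₁ y)) | ≥⇒<ᵇ≡false (m≤m+n s₁ y)
          | m+n∸m≡n s₁ y | s₁+y∸s₂≡c+y y = refl

  greedy-total-≤ : ∀ n h → proj₁ (greedy n h) + proj₂ (greedy n h) ≤ h
  greedy-total-≤ zero    h = z≤n
  greedy-total-≤ (suc n) h with range h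
  ... | below h<s₂ rewrite greedy-below (suc n) h<s₂ = z≤n
  ... | middle {y} y<c rewrite greedy-middle n y<c = move-total-≤ s₂ (greedy-total-≤ n y)
  ... | above y rewrite greedy-above n y = move-total-≤ s₁ (greedy-total-≤ n y)

  greedy-first-≤ : ∀ n h → proj₁ (greedy n h) ≤ h
  greedy-first-≤ n h = ≤-trans (m≤m+n _ _) (greedy-total-≤ n h)

  module _ (1≤s₂ : 1 ≤ s₂) where

    greedy-fuel : ∀ {m n} h → h < m → h < n → greedy m h ≡ greedy n h
    greedy-fuel {suc m} {suc n} h h<m h<n with range h
    ... | below h<s₂ = trans (greedy-below (suc m) h<s₂) (sym (greedy-below (suc n) h<s₂))
    ... | middle {y} y<c = begin
      greedy (suc m) (s₂ + y) ≡⟨ greedy-middle m y<c ⟩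
      move s₂ (greedy m y)    ≡⟨ cong (move s₂) (greedy-fuel y (s+y<1+n⇒y<n 1≤s₂ h<m) (s+y<1+n⇒y<n 1≤s₂ h<n)) ⟩
      move s₂ (greedy n y)    ≡⟨ greedy-middle n y<c ⟨
      greedy (suc n) (s₂ + y) ∎
      where open ≡-Reasoning
    ... | above y = begin
      greedy (suc m) (s₁ + y) ≡⟨ greedy-above m y ⟩
      move s₁ (greedy m y)    ≡⟨ cong (move s₁) (greedy-fuel y (s+y<1+n⇒y<n 1≤s₁ h<m) (s+y<1+n⇒y<n 1≤s₁ h<n)) ⟩
      move s₁ (greedy n y)    ≡⟨ greedy-above n y ⟨
      greedy (suc n) (s₁ + y) ∎
      where
      open ≡-Reasoning
      1≤s₁ : 1 ≤ s₁
      1≤s₁ = ≤-trans 1≤s₂ (m≤m+n s₂ c)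

    module _ (s₂≤c : s₂ ≤ c) where

      0<c : 0 < c
      0<c = ≤-trans 1≤s₂ s₂≤c

      c+m≡s₂+[c∸s₂+m] : ∀ m → c + m ≡ s₂ + (c ∸ s₂ + m)
      c+m≡s₂+[c∸s₂+m] m = begin
        c + m                ≡⟨ cong (_+ m) (m+[n∸m]≡n s₂≤c) ⟨
        s₂ + (c ∸ s₂) + m    ≡⟨ +-assoc s₂ (c ∸ s₂) m ⟩
        s₂ + (c ∸ s₂ + m)    ∎
        where open ≡-Reasoning

      c∸s₂+m<c : ∀ {m} → m < s₂ → c ∸ s₂ + m < c
      c∸s₂+m<c {m} m<s₂ = subst (c ∸ s₂ + m <_) (m∸n+n≡m s₂≤c) (+-monoʳ-< (c ∸ s₂) m<s₂)

      greedy-c+below : ∀ n {m} → m < s₂ → greedy (suc n) (c + m) ≡ move s₂ (greedy n (c ∸ s₂ + m))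
      greedy-c+below n {m} m<s₂ rewrite c+m≡s₂+[c∸s₂+m] m = greedy-middle n (c∸s₂+m<c m<s₂)

      move-s₂-⊑₁ : ∀ n {y} → y < c → move s₂ (greedy n y) ⊑₁ (c + 0 , 0)
      move-s₂-⊑₁ zero    y<c = ≤⇒⊑₁ (+-monoˡ-≤ 0 s₂≤c)
      move-s₂-⊑₁ (suc n) {y} y<c with range y
      ... | below y<s₂ rewrite greedy-below (suc n) y<s₂ = ≤⇒⊑₁ (+-monoˡ-≤ 0 s₂≤c)
      ... | middle {z} z<c rewrite greedy-middle n z<c =
        [ ≤-<-trans (+-monoʳ-≤ s₂ (greedy-first-≤ n z)) (<-≤-trans y<c (m≤m+n c 0)) ]
      ... | above z = ⊥-elim (<⇒≱ y<c (≤-trans (m≤n+m c s₂) (m≤m+n s₁ z)))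

      c+[s₂+y]≡s₁+y : ∀ y → c + (s₂ + y) ≡ s₁ + y
      c+[s₂+y]≡s₁+y y = trans (x∙yz≈y∙xz c s₂ y) (sym (+-assoc s₂ c y))

      mutual
        first-mover : ∀ n m → greedy n (c + m) ⊑₁ map₁ (c +_) (greedy n m)
        first-mover zero    m = [ <-≤-trans 0<c (m≤m+n c 0) ]
        first-mover (suc n) m with range m
        ... | below m<s₂ rewrite greedy-below (suc n) m<s₂ | greedy-c+below n m<s₂ =
          move-s₂-⊑₁ n (c∸s₂+m<c m<s₂)
        ... | middle {y} y<c rewrite c+[s₂+y]≡s₁+y y | greedy-above n y | greedy-middle n y<c =
          reflexive (trans (move-+ s₂ c (greedy n y)) (move-map₂ s₂ c (greedy n y)))
        ... | above y rewrite x∙yz≈y∙xz c s₁ y | greedy-above n (c + y) | greedy-above n y =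
          subst (move s₁ (greedy n (c + y)) ⊑₁_) (move-map₂ s₁ c (greedy n y))
            (move-mono₂ s₁ (second-mover n y))

        second-mover : ∀ n m → greedy n (c + m) ⊑₂ map₂ (c +_) (greedy n m)
        second-mover zero    m = [ <-≤-trans 0<c (m≤m+n c 0) ]
        second-mover (suc n) m with range m
        ... | below m<s₂ rewrite greedy-below (suc n) m<s₂ | greedy-c+below n m<s₂ =
          [ ≤-<-trans (greedy-first-≤ n _) (<-≤-trans (c∸s₂+m<c m<s₂) (m≤m+n c 0)) ]
        ... | middle {y} y<c rewrite c+[s₂+y]≡s₁+y y | greedy-above n y | greedy-middle n y<c =
          [ m<n+m _ 0<c ]
        ... | above y rewrite x∙yz≈y∙xz c s₁ y | greedy-above n (c + y) | greedy-above n y =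
          move-mono₁ s₁ (first-mover n y)

      sacrifice-⊑₁-greedy : ∀ n m → move s₂ (greedy n (c + m)) ⊑₁ move s₁ (greedy n m)
      sacrifice-⊑₁-greedy n m =
        subst (move s₂ (greedy n (c + m)) ⊑₁_) (sym (move-+ s₂ c (greedy n m)))
          (move-mono₂ s₂ (second-mover n m))

      outF≡greedy : ∀ n X h → outF s₁ s₂ n X h ≡ greedy n h
      outF≡greedy zero    X h = refl
      outF≡greedy (suc n) X h with range h
      ... | below h<s₂ = trans (outF-below n X h<s₂) (sym (greedy-below (suc n) h<s₂))
      ... | middle {y} y<c = begin
        outF s₁ s₂ (suc n) X (s₂ + y)  ≡⟨ outF-middle n X y<c ⟩
        move s₂ (outF s₁ s₂ n (d X) y) ≡⟨ cong (move s₂) (outF≡greedy n (d X) y) ⟩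
        move s₂ (greedy n y)           ≡⟨ greedy-middle n y<c ⟨
        greedy (suc n) (s₂ + y)        ∎
        where open ≡-Reasoning
      ... | above y = begin
        outF s₁ s₂ (suc n) X (s₁ + y)
          ≡⟨ outF-above n X y ⟩
        choose X (move s₁ (outF s₁ s₂ n (d X) y)) (move s₂ (outF s₁ s₂ n (d X) (c + y)))
          ≡⟨ cong₂ (λ p q → choose X (move s₁ p) (move s₂ q))
                   (outF≡greedy n (d X) y) (outF≡greedy n (d X) (c + y)) ⟩
        choose X (move s₁ (greedy n y)) (move s₂ (greedy n (c + y)))
          ≡⟨ choose-⊑₁ X (sacrifice-⊑₁-greedy n y) ⟩
        move s₁ (greedy n y)
          ≡⟨ greedy-above n y ⟨
        greedy (suc n) (s₁ + y) ∎
        where open ≡-Reasoning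

      o²≡greedy : ∀ X {n} h → h < n → o² s₁ s₂ X h ≡ proj₂ (greedy n h)
      o²≡greedy X {n} h h<n = cong proj₂ (trans (outF≡greedy (suc h) X h) (greedy-fuel h ≤-refl h<n))

      sacrifice-unprofitable : ∀ X h → s₁ ≤ h → s₂ + o² s₁ s₂ X (h ∸ s₂) ≤ s₁ + o² s₁ s₂ X (h ∸ s₁)
      sacrifice-unprofitable X h s₁≤h with m≤n⇒∃[o]m+o≡n s₁≤h
      ... | m , refl
        rewrite s₁+y∸s₂≡c+y m | m+n∸m≡n s₁ m
              | o²≡greedy X (c + m) (≤-refl {suc (c + m)}) | o²≡greedy X m (s≤s (m≤n+m m c)) =
        ⊑₁⇒≤ (sacrifice-⊑₁-greedy (suc (c + m)) m)

lemma2 : (s₁ s₂ : ℕ) → 1 ≤ s₂ → s₂ < s₁ → 2 * s₂ ≤ s₁ →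
    (X : Setting) → (h : ℕ) → s₁ ≤ h →
    s₂ + o² s₁ s₂ (d X) (h ∸ s₂) ≤ s₁ + o² s₁ s₂ (d X) (h ∸ s₁)
lemma2 s₁ s₂ 1≤s₂ s₂<s₁ 2s₂≤s₁ X h s₁≤h with m≤n⇒∃[o]m+o≡n (<⇒≤ s₂<s₁)
... | c , refl = Greedy.sacrifice-unprofitable s₂ c 1≤s₂ s₂≤c (d X) h s₁≤h
  where
  s₂≤c : s₂ ≤ c
  s₂≤c = ≤-trans (m≤m+n s₂ 0) (+-cancelˡ-≤ s₂ _ c 2s₂≤s₁)
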